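{- Let $M$ be a closed term of the $\partial_0\lambda$-calculus (without tests). If $M\twoheadrightarrow\mathbf I+\mathbb M$ for some finite sum of terms $\mathbb M$, then there is a finite sequence $P_1,\dots,P_m$ of closed bags such that $MP_1\cdots P_m\twoheadrightarrow\mathbf I$.
   Context: The $\partial_0\lambda$-calculus (without tests). Terms $M::=x\mid\lambda x.M\mid MP$, bags $P::=[L_1,\dots,L_k]$ ($k\ge0$, a finite multiset of terms), up to $\alpha$-equivalence. Sums of terms are finite formal sums with idempotent addition ($M+M=M$), $0$ the empty sum; constructors are extended to sums multilinearly (e.g. $\lambda x.\sum_iM_i=\sum_i\lambda x.M_i$, $(\sum_iM_i)(\sum_jP_j)=\sum_{i,j}M_iP_j$, $[\sum_iL_i]\uplus P=\sum_i[L_i]\uplus P$), so constructors applied to $0$ give $0$. $A\{0/x\}$ equals $0$ if $x$ is free in $A$ and $A$ otherwise. Linear substitution: $x\langle N/x\rangle=N$, $y\langle N/x\rangle=0$ ($y\ne x$), $(\lambda y.M)\langle N/x\rangle=\lambda y.M\langle N/x\rangle$, $(MP)\langle N/x\rangle=M\langle N/x\rangle P+M(P\langle N/x\rangle)$, $[L_1,\dots,L_k]\langle N/x\rangle=\sum_i[L_1,\dots,L_i\langle N/x\rangle,\dots,L_k]$; for $P=[L_1,\dots,L_k]$ with $x$ not free in $P$, $A\langle P/x\rangle:=A\langle L_1/x\rangle\cdots\langle L_k/x\rangle$. The only reduction rule is $(\lambda x.M)P\to M\langle P/x\rangle\{0/x\}$, closed under all syntactic positions and under sums ($A+\mathbb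 B\to\mathbb A+\mathbb B$ if $A\to\mathbb A$); $\twoheadrightarrow$ is the reflexive-transitive closure. $\mathbf I:=\lambda x.x$. -}

module Defs where

-- The ∂₀λ-calculus without tests, with de Bruijn indices (so terms are
-- automatically taken up to α-equivalence).  Bags are lists taken up to
-- permutation (relation _≈b_), finite sums of terms are lists taken up to
-- set equality modulo _≈_ (relation _≃_), which realises idempotency,
-- commutativity and associativity of +, with [] the empty sum 0.

open import Data.Nat using (ℕ; zero; suc; pred; _≡ᵇ_; _<ᵇ_; _≤ᵇ_)
open import Data.Bool using (Bool; true; false; T; if_then_else_; _∨_)
open import Data.List using (List; []; _∷_; _++_; map; concatMap; foldl; [_])
open import Data.List.Relation.Unary.All using (All)
open import Data.List.Relation.Unary.Any using (Any)
open import Data.Product using (Σ; ∃; _×_; _,_)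
open import Relation.Binary.Construct.Closure.ReflexiveTransitive using (Star)

data Tm : Set where
  var : ℕ → Tm
  lam : Tm → Tm
  app : Tm → List Tm → Tm

Bag : Set
Bag = List Tm

Sum : Set
Sum = List Tm

I : Tm
I = lam (var 0)

mutual
  data WS : ℕ → Tm → Set where
    var : ∀ {n i} → T (i <ᵇ n) → WS n (var i)
    lam : ∀ {n M} → WS (suc n) M → WS n (lam M)
    app : ∀ {n M P} → WS n M → WSb n P → WS n (app M P)

  data WSb : ℕ → Bag → Set where
    []  : ∀ {n} → WSb n []
    _∷_ : ∀ {n L P} → WS n L → WSb n P → WSb n (L ∷ P)

Closed : Tm → Set
Closed = WS 0

ClosedBag : Bag → Set
ClosedBag = WSb 0

mutual
  shift : ℕ → Tm → Tm
  shift c (var i) = if i <ᵇ c then var i else var (suc i)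
  shift c (lam M) = lam (shift (suc c) M)
  shift c (app M P) = app (shift c M) (shiftB c P)

  shiftB : ℕ → Bag → Bag
  shiftB c [] = []
  shiftB c (L ∷ P) = shift c L ∷ shiftB c P

-- lowering free variables > c down by one (used when var c is absent)
mutual
  lower : ℕ → Tm → Tm
  lower c (var i) = if i ≤ᵇ c then var i else var (pred i)
  lower c (lam M) = lam (lower (suc c) M)
  lower c (app M P) = app (lower c M) (lowerB c P)

  lowerB : ℕ → Bag → Bag
  lowerB c [] = []
  lowerB c (L ∷ P) = lower c L ∷ lowerB c P

mutual
  occurs : ℕ → Tm → Bool
  occurs k (var i) = i ≡ᵇ k
  occurs k (lam M) = occurs (suc k) M
  occurs k (app M P) = occurs k M ∨ occursB k P

  occursB : ℕ → Bag → Bool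
  occursB k [] = false
  occursB k (L ∷ P) = occurs k L ∨ occursB k P

mutual
  lin : ℕ → Tm → Tm → Sum
  lin k N (var i) = if i ≡ᵇ k then [ N ] else []
  lin k N (lam M) = map lam (lin (suc k) (shift 0 N) M)
  lin k N (app M P) = map (λ M' → app M' P) (lin k N M) ++ map (app M) (linB k N P)

  linB : ℕ → Tm → Bag → List Bag
  linB k N [] = []
  linB k N (L ∷ P) = map (_∷ P) (lin k N L) ++ map (L ∷_) (linB k N P)

linAll : ℕ → Bag → Sum → Sum
linAll k [] S = S
linAll k (L ∷ P) S = linAll k P (concatMap (lin k L) S)

-- A{0/0} followed by removal of the binder (lowering indices)
erase0 : Tm → Sum
erase0 A = if occurs 0 A then [] else [ lower 0 A ]

-- contractum of (λx.M)P :  M⟨P/x⟩{0/x}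
reduct : Tm → Bag → Sum
reduct M P = concatMap erase0 (linAll 0 (shiftB 0 P) [ M ])

mutual
  data _⟶_ : Tm → Sum → Set where
    β    : ∀ {M P} → app (lam M) P ⟶ reduct M P
    lamξ : ∀ {M S} → M ⟶ S → lam M ⟶ map lam S
    appL : ∀ {M P S} → M ⟶ S → app M P ⟶ map (λ M' → app M' P) S
    appR : ∀ {M P Ps} → P ⟶b Ps → app M P ⟶ map (app M) Ps

  data _⟶b_ : Bag → List Bag → Set where
    here  : ∀ {L P S} → L ⟶ S → (L ∷ P) ⟶b map (_∷ P) S
    there : ∀ {L P Ps} → P ⟶b Ps → (L ∷ P) ⟶b map (L ∷_) Ps

mutual
  data _≈_ : Tm → Tm → Set where
    var : ∀ {i} → var i ≈ var i
    lam : ∀ {M N} → M ≈ N → lam M ≈ lam N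
    app : ∀ {M N P Q} → M ≈ N → P ≈b Q → app M P ≈ app N Q

  data _≈b_ : Bag → Bag → Set where
    nil  : [] ≈b []
    cons : ∀ {L L' P Q₁ Q₂} → L ≈ L' → P ≈b (Q₁ ++ Q₂) →
           (L ∷ P) ≈b (Q₁ ++ L' ∷ Q₂)

_≃_ : Sum → Sum → Set
S ≃ T = All (λ A → Any (A ≈_) T) S × All (λ B → Any (B ≈_) S) T

_⇒_ : Sum → Sum → Set
S ⇒ T = Σ Tm λ A → Σ Sum λ 𝔹 → Σ Sum λ 𝔸 →
          (S ≃ (A ∷ 𝔹)) × (A ⟶ 𝔸) × (T ≃ (𝔸 ++ 𝔹))

_↠_ : Sum → Sum → Set
S ↠ T = Σ Sum λ T' → Star _⇒_ S T' × (T' ≃ T)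

apps : Tm → List Bag → Tm
apps M Ps = foldl app M Ps

-- Feeding a closed term N enough copies of the bag [I] makes it reduce to a
-- finite sum of copies of I (possibly 0), and to a sum containing I when N
-- is I itself.  This is proved by lexicographic induction on (size, weight):
-- an application makes a head β-step, which lowers the size, and an
-- abstraction λx.t other than I consumes one [I], which keeps the size but
-- lowers the weight.  As reduction is closed under application contexts,
-- M [I]⋯[I] reduces to (I + 𝕄)[I]⋯[I]; with enough copies of [I] every
-- summand collapses and the one coming from I survives, giving I by
-- idempotency of the sum.

module Submission where

open import Defs
open import Data.Bool using (true; false; T; _∨_)
open import Data.Empty using (⊥-elim)
open import Data.List using (List; []; _∷_; _++_; map; concatMap; replicate; [_])
open import Data.List.Properties using (map-++; map-∘; map-id; map-cong; ++-assoc; ++-identityʳ)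
open import Data.List.Membership.Propositional using (_∈_)
open import Data.List.Relation.Binary.Permutation.Propositional using (_↭_)
open import Data.List.Relation.Binary.Permutation.Propositional.Properties
  using (All-resp-↭; Any-resp-↭; ++-comm)
open import Data.List.Relation.Unary.All as All using (All; []; _∷_)
import Data.List.Relation.Unary.All.Properties as Allₚ
open import Data.List.Relation.Unary.Any as Any using (Any; here; there)
import Data.List.Relation.Unary.Any.Properties as Anyₚ
open import Data.Nat using (ℕ; zero; suc; pred; _+_; _≤_; _<_; z≤n; s≤s; _≡ᵇ_; _<ᵇ_; _≤ᵇ_)
open import Data.Nat.Properties
  using ( +-assoc; +-comm; +-identityʳ; +-monoˡ-≤; ≤-refl; ≤-trans; ≤-reflexive; <-≤-trans
        ; ≤-<-trans; n<1+n; m<n⇒m<1+n; pred[n]≤n; ≤∧≢⇒<; ≰⇒>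
        ; <ᵇ⇒<; <⇒<ᵇ; ≤ᵇ⇒≤; ≤⇒≤ᵇ; ≡ᵇ⇒≡; ≡⇒≡ᵇ; +-commutativeSemigroup)
open import Algebra.Properties.CommutativeSemigroup +-commutativeSemigroup using (xy∙z≈xz∙y)
open import Data.Product using (Σ; _×_; _,_)
open import Data.Sum using (_⊎_; inj₁; inj₂)
open import Data.Unit using (tt)
open import Function using (_∘_)
open import Relation.Binary.PropositionalEquality using (_≡_; refl; sym; trans; cong; cong₂; subst)
open import Relation.Binary.Construct.Closure.ReflexiveTransitive using (Star; ε; _◅_; _◅◅_; gmap)
open import Relation.Nullary using (¬_)

concatMap⁺ : {A B : Set} {P : A → Set} {Q : B → Set} {f : A → List B} {xs : List A} →
  (∀ {x} → P x → All Q (f x)) → All P xs → All Q (concatMap f xs)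
concatMap⁺ g = Allₚ.concat⁺ ∘ Allₚ.gmap⁺ g

mutual
  ≈-refl : ∀ M → M ≈ M
  ≈-refl (var i) = var
  ≈-refl (lam M) = lam (≈-refl M)
  ≈-refl (app M P) = app (≈-refl M) (≈b-refl P)

  ≈b-refl : ∀ P → P ≈b P
  ≈b-refl [] = nil
  ≈b-refl (L ∷ P) = cons {Q₁ = []} (≈-refl L) (≈b-refl P)

I≈⇒≡ : ∀ {A} → I ≈ A → I ≡ A
I≈⇒≡ (lam var) = refl

_⊑_ : Sum → Sum → Set
S ⊑ T = All (λ A → Any (A ≈_) T) S

⊑-refl : ∀ S → S ⊑ S
⊑-refl [] = []
⊑-refl (A ∷ S) = here (≈-refl A) ∷ All.map there (⊑-refl S)

⊑-++ : ∀ {S S′ T T′} → S ⊑ S′ → T ⊑ T′ → (S ++ T) ⊑ (S′ ++ T′)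
⊑-++ {S′ = S′} p q = Allₚ.++⁺ (All.map Anyₚ.++⁺ˡ p) (All.map (Anyₚ.++⁺ʳ S′) q)

⊑-map : ∀ (f : Tm → Tm) → (∀ {A B} → A ≈ B → f A ≈ f B) →
  ∀ {S T} → S ⊑ T → map f S ⊑ map f T
⊑-map f f-cong = Allₚ.gmap⁺ (Anyₚ.gmap f-cong)

≃-refl : ∀ S → S ≃ S
≃-refl S = ⊑-refl S , ⊑-refl S

≃-++ : ∀ {S S′ T T′} → S ≃ S′ → T ≃ T′ → (S ++ T) ≃ (S′ ++ T′)
≃-++ (p , p′) (q , q′) = ⊑-++ p q , ⊑-++ p′ q′

≃-map : ∀ (f : Tm → Tm) → (∀ {A B} → A ≈ B → f A ≈ f B) →
  ∀ {S T} → S ≃ T → map f S ≃ map f T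
≃-map f f-cong (p , q) = ⊑-map f f-cong p , ⊑-map f f-cong q

≃-respˡ-↭ : ∀ {S S′ T} → S ↭ S′ → S ≃ T → S′ ≃ T
≃-respˡ-↭ σ (p , q) = All-resp-↭ σ p , All.map (Any-resp-↭ σ) q

⟶-⇒ : ∀ {A 𝔸} → A ⟶ 𝔸 → [ A ] ⇒ 𝔸
⟶-⇒ {A} {𝔸} st = A , [] , 𝔸 , ≃-refl [ A ] , st , subst (𝔸 ≃_) (sym (++-identityʳ 𝔸)) (≃-refl 𝔸)

⇒-resp-↭ : ∀ {S S′ T T′} → S ↭ S′ → T ↭ T′ → S ⇒ T → S′ ⇒ T′
⇒-resp-↭ σ τ (A , 𝔹 , 𝔸 , S≃ , st , T≃) = A , 𝔹 , 𝔸 , ≃-respˡ-↭ σ S≃ , st , ≃-respˡ-↭ τ T≃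

⇒-++ʳ : ∀ {S T} R → S ⇒ T → (S ++ R) ⇒ (T ++ R)
⇒-++ʳ {T = T} R (A , 𝔹 , 𝔸 , S≃ , st , T≃) =
  A , 𝔹 ++ R , 𝔸 , ≃-++ S≃ (≃-refl R) , st ,
  subst ((T ++ R) ≃_) (++-assoc 𝔸 𝔹 R) (≃-++ T≃ (≃-refl R))

⇒-++ˡ : ∀ {S T} R → S ⇒ T → (R ++ S) ⇒ (R ++ T)
⇒-++ˡ {S} {T} R = ⇒-resp-↭ (++-comm S R) (++-comm T R) ∘ ⇒-++ʳ R

⇒*-++ : ∀ {S S′ T T′} → Star _⇒_ S S′ → Star _⇒_ T T′ → Star _⇒_ (S ++ T) (S′ ++ T′)
⇒*-++ {S′ = S′} {T = T} S⇒* T⇒* = gmap (_++ T) (⇒-++ʳ T) S⇒* ◅◅ gmap (S′ ++_) (⇒-++ˡ S′) T⇒*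

apps-cong : ∀ Ps {A B} → A ≈ B → apps A Ps ≈ apps B Ps
apps-cong [] A≈B = A≈B
apps-cong (P ∷ Ps) A≈B = apps-cong Ps (app A≈B (≈b-refl P))

apps-⟶ : ∀ Ps {A 𝔸} → A ⟶ 𝔸 → apps A Ps ⟶ map (λ X → apps X Ps) 𝔸
apps-⟶ [] {𝔸 = 𝔸} st = subst (_ ⟶_) (sym (map-id 𝔸)) st
apps-⟶ (P ∷ Ps) {𝔸 = 𝔸} st = subst (_ ⟶_) (sym (map-∘ 𝔸)) (apps-⟶ Ps (appL st))

⇒-apps : ∀ Ps {S T} → S ⇒ T → map (λ X → apps X Ps) S ⇒ map (λ X → apps X Ps) T
⇒-apps Ps {T = T} (A , 𝔹 , 𝔸 , S≃ , st , T≃) =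
  apps A Ps , map f 𝔹 , map f 𝔸 , ≃-map f (apps-cong Ps) S≃ , apps-⟶ Ps st ,
  subst (map f T ≃_) (map-++ f 𝔸 𝔹) (≃-map f (apps-cong Ps) T≃)
  where
  f : Tm → Tm
  f X = apps X Ps

⇒*-apps : ∀ Ps {S T} → Star _⇒_ S T →
  Star _⇒_ (map (λ X → apps X Ps) S) (map (λ X → apps X Ps) T)
⇒*-apps Ps = gmap (map (λ X → apps X Ps)) (⇒-apps Ps)

-- Closed terms reduce to sums of closed terms

∨-≡false⁻ : ∀ a {b} → a ∨ b ≡ false → a ≡ false × b ≡ false
∨-≡false⁻ false refl = refl , refl

mutual
  WS-shift : ∀ {n} c A → WS n A → WS (suc n) (shift c A)
  WS-shift {n} c (var i) (var i<n) with i <ᵇ c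
  ... | true = var (<⇒<ᵇ (m<n⇒m<1+n (<ᵇ⇒< i n i<n)))
  ... | false = var i<n
  WS-shift c (lam M) (lam w) = lam (WS-shift (suc c) M w)
  WS-shift c (app M P) (app w wb) = app (WS-shift c M w) (WSb-shift c P wb)

  WSb-shift : ∀ {n} c P → WSb n P → WSb (suc n) (shiftB c P)
  WSb-shift c [] [] = []
  WSb-shift c (L ∷ P) (w ∷ wb) = WS-shift c L w ∷ WSb-shift c P wb

mutual
  WS-lin : ∀ {n} k N t → WS n N → WS n t → All (WS n) (lin k N t)
  WS-lin k N (var i) wN w with i ≡ᵇ k
  ... | true = wN ∷ []
  ... | false = []
  WS-lin k N (lam M) wN (lam w) = Allₚ.gmap⁺ lam (WS-lin (suc k) (shift 0 N) M (WS-shift 0 N wN) w)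
  WS-lin k N (app M P) wN (app w wb) =
    Allₚ.++⁺ (Allₚ.gmap⁺ (λ w′ → app w′ wb) (WS-lin k N M wN w))
             (Allₚ.gmap⁺ (app w) (WSb-lin k N P wN wb))

  WSb-lin : ∀ {n} k N P → WS n N → WSb n P → All (WSb n) (linB k N P)
  WSb-lin k N [] wN [] = []
  WSb-lin k N (L ∷ P) wN (w ∷ wb) =
    Allₚ.++⁺ (Allₚ.gmap⁺ (_∷ wb) (WS-lin k N L wN w))
             (Allₚ.gmap⁺ (w ∷_) (WSb-lin k N P wN wb))

WS-linAll : ∀ {n} k P S → WSb n P → All (WS n) S → All (WS n) (linAll k P S)
WS-linAll k [] S [] wS = wS
WS-linAll k (L ∷ P) S (w ∷ wb) wS = WS-linAll k P _ wb (concatMap⁺ (WS-lin k L _ w) wS)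

mutual
  WS-lower : ∀ {n} c A → occurs c A ≡ false → c ≤ n → WS (suc n) A → WS n (lower c A)
  WS-lower {n} c (var i) i≢c c≤n (var i<1+n) with i ≤ᵇ c in eq
  ... | true = var (<⇒<ᵇ (≤-trans i<c c≤n))
    where
    i<c : i < c
    i<c = ≤∧≢⇒< (≤ᵇ⇒≤ i c (subst T (sym eq) tt)) (subst T i≢c ∘ ≡⇒≡ᵇ i c)
  ... | false = var-pred i i<1+n (≰⇒> (subst T eq ∘ ≤⇒≤ᵇ))
    where
    var-pred : ∀ i → T (i <ᵇ suc n) → c < i → WS n (var (pred i))
    var-pred (suc i) i<n _ = var i<n
  WS-lower c (lam M) oc c≤n (lam w) = lam (WS-lower (suc c) M oc (s≤s c≤n) w)
  WS-lower c (app M P) oc c≤n (app w wb) with ∨-≡false⁻ (occurs c M) oc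
  ... | ocM , ocP = app (WS-lower c M ocM c≤n w) (WSb-lower c P ocP c≤n wb)

  WSb-lower : ∀ {n} c P → occursB c P ≡ false → c ≤ n → WSb (suc n) P → WSb n (lowerB c P)
  WSb-lower c [] oc c≤n [] = []
  WSb-lower c (L ∷ P) oc c≤n (w ∷ wb) with ∨-≡false⁻ (occurs c L) oc
  ... | ocL , ocP = WS-lower c L ocL c≤n w ∷ WSb-lower c P ocP c≤n wb

WS-erase0 : ∀ {n} A → WS (suc n) A → All (WS n) (erase0 A)
WS-erase0 A w with occurs 0 A in eq
... | true = []
... | false = WS-lower 0 A eq z≤n w ∷ []

WS-reduct : ∀ {n} M P → WS (suc n) M → WSb n P → All (WS n) (reduct M P)
WS-reduct M P w wb =
  concatMap⁺ (WS-erase0 _) (WS-linAll 0 (shiftB 0 P) [ M ] (WSb-shift 0 P wb) (w ∷ []))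

mutual
  WS-⟶ : ∀ {n A 𝔸} → WS n A → A ⟶ 𝔸 → All (WS n) 𝔸
  WS-⟶ (app (lam w) wb) β = WS-reduct _ _ w wb
  WS-⟶ (lam w) (lamξ st) = Allₚ.gmap⁺ lam (WS-⟶ w st)
  WS-⟶ (app w wb) (appL st) = Allₚ.gmap⁺ (λ w′ → app w′ wb) (WS-⟶ w st)
  WS-⟶ (app w wb) (appR st) = Allₚ.gmap⁺ (app w) (WSb-⟶ wb st)

  WSb-⟶ : ∀ {n P Ps} → WSb n P → P ⟶b Ps → All (WSb n) Ps
  WSb-⟶ (w ∷ wb) (here st) = Allₚ.gmap⁺ (_∷ wb) (WS-⟶ w st)
  WSb-⟶ (w ∷ wb) (there st) = Allₚ.gmap⁺ (w ∷_) (WSb-⟶ wb st)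

WSb-++⁻ : ∀ {n} Q₁ {Q₂} → WSb n (Q₁ ++ Q₂) → WSb n Q₁ × WSb n Q₂
WSb-++⁻ [] wb = [] , wb
WSb-++⁻ (L ∷ Q₁) (w ∷ wb) with WSb-++⁻ Q₁ wb
... | wb₁ , wb₂ = w ∷ wb₁ , wb₂

WSb-++⁺ : ∀ {n} Q₁ {Q₂} → WSb n Q₁ → WSb n Q₂ → WSb n (Q₁ ++ Q₂)
WSb-++⁺ [] [] wb₂ = wb₂
WSb-++⁺ (L ∷ Q₁) (w ∷ wb₁) wb₂ = w ∷ WSb-++⁺ Q₁ wb₁ wb₂

mutual
  WS-≈⁻ : ∀ {n M N} → M ≈ N → WS n N → WS n M
  WS-≈⁻ var w = w
  WS-≈⁻ (lam M≈N) (lam w) = lam (WS-≈⁻ M≈N w)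
  WS-≈⁻ (app M≈N P≈Q) (app w wb) = app (WS-≈⁻ M≈N w) (WSb-≈⁻ P≈Q wb)

  WSb-≈⁻ : ∀ {n P Q} → P ≈b Q → WSb n Q → WSb n P
  WSb-≈⁻ nil wb = wb
  WSb-≈⁻ (cons {Q₁ = Q₁} L≈L′ P≈Q) wb with WSb-++⁻ Q₁ wb
  ... | wb₁ , (w ∷ wb₂) = WS-≈⁻ L≈L′ w ∷ WSb-≈⁻ P≈Q (WSb-++⁺ Q₁ wb₁ wb₂)

⊑-Closed : ∀ {S T} → S ⊑ T → All Closed T → All Closed S
⊑-Closed S⊑T cT = All.map (closed-witness cT) S⊑T
  where
  closed-witness : ∀ {A T} → All Closed T → Any (A ≈_) T → Closed A
  closed-witness (c ∷ _) (here A≈B) = WS-≈⁻ A≈B c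
  closed-witness (_ ∷ cs) (there A∈T) = closed-witness cs A∈T

⇒-Closed : ∀ {S T} → All Closed S → S ⇒ T → All Closed T
⇒-Closed cS (A , 𝔹 , 𝔸 , (_ , A𝔹⊑S) , st , (T⊑𝔸𝔹 , _)) with ⊑-Closed A𝔹⊑S cS
... | cA ∷ c𝔹 = ⊑-Closed T⊑𝔸𝔹 (Allₚ.++⁺ (WS-⟶ cA st) c𝔹)

⇒*-Closed : ∀ {S T} → All Closed S → Star _⇒_ S T → All Closed T
⇒*-Closed cS ε = cS
⇒*-Closed cS (st ◅ sts) = ⇒*-Closed (⇒-Closed cS st) sts

-- Size

-- Variables weigh nothing, so that linear substitution adds sizes: a β-step
-- lowers the size and feeding [I] to λx.t preserves it.
mutual
  size : Tm → ℕ
  size (var _) = 0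
  size (lam M) = suc (size M)
  size (app M P) = suc (size M + sizeB P)

  sizeB : Bag → ℕ
  sizeB [] = 0
  sizeB (L ∷ P) = size L + sizeB P

mutual
  size-shift : ∀ c A → size (shift c A) ≡ size A
  size-shift c (var i) with i <ᵇ c
  ... | true = refl
  ... | false = refl
  size-shift c (lam M) = cong suc (size-shift (suc c) M)
  size-shift c (app M P) = cong suc (cong₂ _+_ (size-shift c M) (sizeB-shift c P))

  sizeB-shift : ∀ c P → sizeB (shiftB c P) ≡ sizeB P
  sizeB-shift c [] = refl
  sizeB-shift c (L ∷ P) = cong₂ _+_ (size-shift c L) (sizeB-shift c P)

mutual
  size-lower : ∀ c A → size (lower c A) ≡ size A
  size-lower c (var i) with i ≤ᵇ c
  ... | true = refl
  ... | false = refl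
  size-lower c (lam M) = cong suc (size-lower (suc c) M)
  size-lower c (app M P) = cong suc (cong₂ _+_ (size-lower c M) (sizeB-lower c P))

  sizeB-lower : ∀ c P → sizeB (lowerB c P) ≡ sizeB P
  sizeB-lower c [] = refl
  sizeB-lower c (L ∷ P) = cong₂ _+_ (size-lower c L) (sizeB-lower c P)

+-pushʳ : ∀ {a} b c n → a ≡ b + n → a + c ≡ b + c + n
+-pushʳ b c n refl = xy∙z≈xz∙y b n c

+-pushˡ : ∀ {a} b c n → a ≡ b + n → c + a ≡ c + b + n
+-pushˡ b c n refl = sym (+-assoc c b n)

mutual
  size-lin : ∀ k N t → All (λ e → size e ≡ size t + size N) (lin k N t)
  size-lin k N (var i) with i ≡ᵇ k
  ... | true = refl ∷ []
  ... | false = []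
  size-lin k N (lam M) =
    Allₚ.gmap⁺ (λ h → cong suc (trans h (cong (size M +_) (size-shift 0 N))))
      (size-lin (suc k) (shift 0 N) M)
  size-lin k N (app M P) =
    Allₚ.++⁺ (Allₚ.gmap⁺ (cong suc ∘ +-pushʳ (size M) (sizeB P) (size N)) (size-lin k N M))
             (Allₚ.gmap⁺ (cong suc ∘ +-pushˡ (sizeB P) (size M) (size N)) (sizeB-lin k N P))

  sizeB-lin : ∀ k N P → All (λ b → sizeB b ≡ sizeB P + size N) (linB k N P)
  sizeB-lin k N [] = []
  sizeB-lin k N (L ∷ P) =
    Allₚ.++⁺ (Allₚ.gmap⁺ (+-pushʳ (size L) (sizeB P) (size N)) (size-lin k N L))
             (Allₚ.gmap⁺ (+-pushˡ (sizeB P) (size L) (size N)) (sizeB-lin k N P))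

size-linAll : ∀ k P {d} S → All (λ M → size M ≡ d) S →
  All (λ e → size e ≡ d + sizeB P) (linAll k P S)
size-linAll k [] {d} S hS = All.map (λ h → trans h (sym (+-identityʳ d))) hS
size-linAll k (L ∷ P) {d} S hS =
  All.map (λ h → trans h (+-assoc d (size L) (sizeB P)))
    (size-linAll k P (concatMap (lin k L) S)
      (concatMap⁺ (λ {M} h → All.map (λ h′ → trans h′ (cong (_+ size L) h)) (size-lin k L M)) hS))

size-erase0 : ∀ A → All (λ e → size e ≡ size A) (erase0 A)
size-erase0 A with occurs 0 A
... | true = []
... | false = size-lower 0 A ∷ []

size-reduct : ∀ M P → All (λ e → size e ≡ size M + sizeB P) (reduct M P)
size-reduct M P =
  concatMap⁺ (λ {A} h → All.map (λ h′ → trans h′ h) (size-erase0 A))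
    (All.map (λ h → trans h (cong (size M +_) (sizeB-shift 0 P)))
      (size-linAll 0 (shiftB 0 P) [ M ] (refl ∷ [])))

size-β : ∀ M P → All (λ e → size e < size (app (lam M) P)) (reduct M P)
size-β M P = All.map (λ h → m<n⇒m<1+n (≤-reflexive (cong suc h))) (size-reduct M P)

size-feedI : ∀ t → All (λ e → size e ≡ size (lam t)) (reduct t [ I ])
size-feedI t = All.map (λ h → trans h (+-comm (size t) 1)) (size-reduct t [ I ])

-- Weight

-- Counting the index of a head variable makes λx.λy⃗.x lose weight when fed
-- [I], although the result λy⃗.I has as many leading λs.
weight : Tm → ℕ
weight (var i) = i
weight (lam M) = suc (weight M)
weight (app _ _) = 0

weight-lin : ∀ k t → All (λ e → weight e ≤ weight t ⊎ (t ≡ var k × e ≡ I)) (lin k I t)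
weight-lin k (var i) with i ≡ᵇ k in eq
... | true = inj₂ (cong var (≡ᵇ⇒≡ i k (subst T (sym eq) tt)) , refl) ∷ []
... | false = []
weight-lin k (lam s) = Allₚ.gmap⁺ under-lam (weight-lin (suc k) s)
  where
  under-lam : ∀ {e} → weight e ≤ weight s ⊎ (s ≡ var (suc k) × e ≡ I) →
    weight (lam e) ≤ weight (lam s) ⊎ (lam s ≡ var k × lam e ≡ I)
  under-lam (inj₁ e≤s) = inj₁ (s≤s e≤s)
  under-lam (inj₂ (refl , refl)) = inj₁ (s≤s (s≤s z≤n))
weight-lin k (app M P) =
  Allₚ.++⁺ (Allₚ.map⁺ {f = λ M′ → app M′ P} (All.universal (λ _ → inj₁ z≤n) (lin k I M)))
           (Allₚ.map⁺ {f = app M} (All.universal (λ _ → inj₁ z≤n) (linB k I P)))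

weight-lower : ∀ c A → weight (lower c A) ≤ weight A
weight-lower c (var i) with i ≤ᵇ c
... | true = ≤-refl
... | false = pred[n]≤n
weight-lower c (lam M) = s≤s (weight-lower (suc c) M)
weight-lower c (app M P) = z≤n

weight-erase0 : ∀ A → All (λ e → weight e ≤ weight A) (erase0 A)
weight-erase0 A with occurs 0 A
... | true = []
... | false = weight-lower 0 A ∷ []

weight-feedI : ∀ t → ¬ t ≡ var 0 → All (λ e → weight e < weight (lam t)) (reduct t [ I ])
weight-feedI t t≢x =
  concatMap⁺ (λ {A} A< → All.map (λ e≤A → ≤-<-trans e≤A A<) (weight-erase0 A))
    (Allₚ.++⁺ (All.map below (weight-lin 0 t)) [])
  where
  below : ∀ {e} → weight e ≤ weight t ⊎ (t ≡ var 0 × e ≡ I) → weight e < weight (lam t)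
  below (inj₁ e≤t) = s≤s e≤t
  below (inj₂ (t≡x , _)) = ⊥-elim (t≢x t≡x)

-- Collapsing closed terms to sums of I

I-closed : Closed I
I-closed = lam (var tt)

head-step : ∀ {M P} → Closed (app M P) →
  Σ Sum λ S → (app M P ⟶ S) × All (λ e → Closed e × size e < size (app M P)) S
head-step {var _} (app (var ()) _)
head-step {lam M} {P} (app (lam w) wb) = reduct M P , β , All.zip (WS-reduct M P w wb , size-β M P)
head-step {app _ _} {P} (app w wb) with head-step w
... | S , st , props =
  map (λ X → app X P) S , appL st ,
  Allₚ.gmap⁺ (λ (c , e<) → app c wb , s≤s (+-monoˡ-≤ (sizeB P) e<)) props

Ibags : ℕ → List Bag
Ibags m = replicate m [ I ]

feedI : ℕ → Tm → Tm
feedI m N = apps N (Ibags m)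

feedI-+ : ∀ m k N → feedI (m + k) N ≡ feedI k (feedI m N)
feedI-+ zero k N = refl
feedI-+ (suc m) k N = feedI-+ m k (app N [ I ])

Collapsible : Tm → Set
Collapsible N = Σ ℕ λ m → Σ Sum λ X →
  Star _⇒_ [ feedI m N ] X × All (_≡ I) X × (N ≡ I → I ∈ X)

feedI-I⇒* : ∀ k → Star _⇒_ [ feedI k I ] [ I ]
feedI-I⇒* zero = ε
feedI-I⇒* (suc k) = ⟶-⇒ (apps-⟶ (Ibags k) β) ◅ feedI-I⇒* k

feedI-Is⇒* : ∀ k {X} → All (_≡ I) X → Star _⇒_ (map (feedI k) X) X
feedI-Is⇒* k [] = ε
feedI-Is⇒* k (refl ∷ X≡I) = ⇒*-++ (feedI-I⇒* k) (feedI-Is⇒* k X≡I)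

feedI-more : ∀ m k {R X} → Star _⇒_ (map (feedI m) R) X → All (_≡ I) X →
  Star _⇒_ (map (feedI (m + k)) R) X
feedI-more m k {R} R⇒*X X≡I =
  subst (λ Z → Star _⇒_ Z _) (sym (trans (map-cong (feedI-+ m k) R) (map-∘ R)))
    (⇒*-apps (Ibags k) R⇒*X ◅◅ feedI-Is⇒* k X≡I)

collapsible-sum : ∀ {R} → All Collapsible R → Σ ℕ λ m → Σ Sum λ X →
  Star _⇒_ (map (feedI m) R) X × All (_≡ I) X × (I ∈ R → I ∈ X)
collapsible-sum [] = 0 , [] , ε , [] , λ ()
collapsible-sum {e ∷ R} ((m₁ , X₁ , e⇒*X₁ , X₁≡I , I∈X₁) ∷ cs) with collapsible-sum cs
... | m₂ , X₂ , R⇒*X₂ , X₂≡I , I∈X₂ =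
  m₁ + m₂ , X₁ ++ X₂ ,
  ⇒*-++ (feedI-more m₁ m₂ e⇒*X₁ X₁≡I)
        (subst (λ m → Star _⇒_ (map (feedI m) R) X₂) (+-comm m₂ m₁) (feedI-more m₂ m₁ R⇒*X₂ X₂≡I)) ,
  Allₚ.++⁺ X₁≡I X₂≡I , I∈
  where
  I∈ : I ∈ e ∷ R → I ∈ X₁ ++ X₂
  I∈ (here I≡e) = Anyₚ.++⁺ˡ (I∈X₁ (sym I≡e))
  I∈ (there I∈R) = Anyₚ.++⁺ʳ X₁ (I∈X₂ I∈R)

collapsible-by-⟶ : ∀ k {N S} → ¬ N ≡ I → feedI k N ⟶ S → All Collapsible S → Collapsible N
collapsible-by-⟶ k {N} N≢I st cs with collapsible-sum cs
... | m , X , S⇒*X , X≡I , _ =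
  k + m , X ,
  subst (λ Z → Star _⇒_ [ Z ] X) (sym (feedI-+ k m N)) (⟶-⇒ (apps-⟶ (Ibags m) st) ◅ S⇒*X) ,
  X≡I , ⊥-elim ∘ N≢I

abstraction-collapsible : ∀ {s f} t → ¬ t ≡ var 0 → WS 1 t →
  size (lam t) < s → weight (lam t) ≤ f →
  (∀ {e} → Closed e → size e < s → weight e < f → Collapsible e) → Collapsible (lam t)
abstraction-collapsible t t≢x w size< weight≤ ih =
  collapsible-by-⟶ 1 (λ { refl → t≢x refl }) β (All.tabulate λ e∈ →
    ih (All.lookup (WS-reduct t [ I ] w (I-closed ∷ [])) e∈)
       (subst (_< _) (sym (All.lookup (size-feedI t) e∈)) size<)
       (<-≤-trans (All.lookup (weight-feedI t t≢x) e∈) weight≤))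

-- s and f are strict bounds on size and weight, decreasing lexicographically.
collapsible-below : ∀ s f N → Closed N → size N < s → weight N < f → Collapsible N
collapsible-below _ _ (var _) (var ()) _ _
collapsible-below _ _ (lam (var zero)) _ _ _ = 0 , [ I ] , ε , refl ∷ [] , λ _ → here refl
collapsible-below _ _ (lam (var (suc _))) (lam (var ())) _ _
collapsible-below _ zero (lam _) _ _ ()
collapsible-below s (suc f) (lam t@(lam _)) (lam w) size< (s≤s weight≤) =
  abstraction-collapsible t (λ ()) w size< weight≤ (collapsible-below s f _)
collapsible-below s (suc f) (lam t@(app _ _)) (lam w) size< (s≤s weight≤) =
  abstraction-collapsible t (λ ()) w size< weight≤ (collapsible-below s f _)
collapsible-below zero _ (app _ _) _ () _
collapsible-below (suc s) _ (app M P) c (s≤s size≤) _ with head-step c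
... | S , st , props =
  collapsible-by-⟶ 0 (λ ()) st
    (All.map (λ {e} (cₑ , e<) →
      collapsible-below s (suc (weight e)) e cₑ (<-≤-trans e< size≤) ≤-refl) props)

Closed⇒Collapsible : ∀ {N} → Closed N → Collapsible N
Closed⇒Collapsible {N} c = collapsible-below _ _ N c (n<1+n (size N)) (n<1+n (weight N))

Is≃[I] : ∀ {X} → All (_≡ I) X → I ∈ X → X ≃ [ I ]
Is≃[I] X≡I I∈X =
  All.map (λ { refl → here (≈-refl I) }) X≡I , Any.map (λ { refl → ≈-refl I }) I∈X ∷ []

lemma6p3 : (M : Tm) → Closed M → (𝕄 : Sum) → [ M ] ↠ (I ∷ 𝕄) →
    Σ (List Bag) (λ Ps → All ClosedBag Ps × [ apps M Ps ] ↠ [ I ])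
lemma6p3 M cM 𝕄 (T , M⇒*T , (_ , I≈T ∷ _))
  with collapsible-sum (All.map Closed⇒Collapsible (⇒*-Closed (cM ∷ []) M⇒*T))
... | m , X , T⇒*X , X≡I , I∈⇒ =
  Ibags m , Allₚ.replicate⁺ m (I-closed ∷ []) ,
  X , ⇒*-apps (Ibags m) M⇒*T ◅◅ T⇒*X , Is≃[I] X≡I (I∈⇒ (Any.map I≈⇒≡ I≈T))
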